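{- Let $f=f_1\otimes\cdots\otimes f_k$ be a morphism of $\mathrm{Mat}_{\mathbb N}$. Then $\mathrm{mwd}(f)\le\max_{i=1,\dots,k}\mathrm{rank}(f_i)+1$. Moreover, if no $f_i$ is $\otimes$-decomposable, then $\max_{i=1,\dots,k}\mathrm{rank}(f_i)\le\mathrm{mwd}(f)$.
   Context: $\mathrm{Mat}_{\mathbb N}$ is the prop (strict symmetric monoidal category with objects the natural numbers, $m\otimes n=m+n$) whose morphisms $n\to m$ are $m\times n$ matrices over $\mathbb N$; the composite of $A\colon n\to k$ followed by $B\colon k\to m$ is $B\cdot A$; $A\otimes B=\begin{pmatrix}A&0\\0&B\end{pmatrix}$. A morphism $f$ is $\otimes$-decomposable if $f=f_1\otimes f_2$ for some $f_1,f_2$ both distinct from $f$. $\mathrm{rank}(A)=\min\{k:A=C\cdot B,\ B\in\mathrm{Mat}_{\mathbb N}(k,n),\ C\in\mathrm{Mat}_{\mathbb N}(m,k)\}$ for $A\in\mathrm{Mat}_{\mathbb N}(m,n)$. Atoms: $\mathrm{cp}_1=\begin{pmatrix}1\\1\end{pmatrix}\colon1\to2$, $\mathrm{del}_1\colon1\to0$ (the $0\times1$ matrix), $\mathrm{add}_1=(1\ 1)\colon2\to1$, $\mathrm{zero}_1\colon0\to1$ (the $1\times0$ matrix), $\sigma_{1,1}=\begin{pmatrix}0&1\\1&0\end{pmatrix}$, $\mathrm{id}_1=(1)$. Weights: $w(n)=n$ on objects, $w(g)=\max\{m,n\}$ for an atom $g\colon n\to m$. Monoidal decompositions $D(f)$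 of $f\colon a\to b$: a leaf $(f)$ if $f$ is an atom; $(d_1\otimes d_2)$ with $d_i\in D(f_i)$, $f=f_1\otimes f_2$; $(d_1;_jd_2)$ with $d_1\in D(f_1\colon a\to j)$, $d_2\in D(f_2\colon j\to b)$, $f$ the composite of $f_1$ then $f_2$. Width: $\mathrm{wd}((f))=w(f)$, $\mathrm{wd}(d_1\otimes d_2)=\max\{\mathrm{wd}(d_1),\mathrm{wd}(d_2)\}$, $\mathrm{wd}(d_1;_jd_2)=\max\{\mathrm{wd}(d_1),j,\mathrm{wd}(d_2)\}$; $\mathrm{mwd}(f)=\min_{d\in D(f)}\mathrm{wd}(d)$. -}

module Defs where

open import Data.Nat using (ℕ; zero; suc; _+_; _*_; _⊔_; _≤_)
open import Data.Fin using (Fin)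
open import Data.Vec using (Vec; []; _∷_; map; tabulate; lookup; zipWith; foldr; _++_; replicate)
open import Data.Product using (Σ; Σ-syntax; ∃; ∃-syntax; _×_; _,_; proj₁; proj₂)
open import Relation.Binary.PropositionalEquality using (_≡_; _≢_)

-- A morphism n → m of Mat_ℕ is an m × n matrix over ℕ, stored as m rows of length n.
Hom : ℕ → ℕ → Set
Hom n m = Vec (Vec ℕ n) m

Mor : Set
Mor = Σ[ n ∈ ℕ ] Σ[ m ∈ ℕ ] Hom n m

pack : ∀ {n m} → Hom n m → Mor
pack {n} {m} f = n , m , f

homOf : (f : Mor) → Hom (proj₁ f) (proj₁ (proj₂ f))
homOf f = proj₂ (proj₂ f)

column : ∀ {k n} → Fin n → Hom n k → Vec ℕ k
column j A = map (λ r → lookup r j) A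

dot : ∀ {k} → Vec ℕ k → Vec ℕ k → ℕ
dot u v = foldr (λ _ → ℕ) _+_ 0 (zipWith _*_ u v)

-- composite of A : n → k followed by B : k → m is the matrix product B · A
_·_ : ∀ {n k m} → Hom k m → Hom n k → Hom n m
B · A = map (λ row → tabulate (λ j → dot row (column j A))) B

-- A ⊗ B = block-diagonal matrix (A 0; 0 B)
_⊗_ : ∀ {n₁ m₁ n₂ m₂} → Hom n₁ m₁ → Hom n₂ m₂ → Hom (n₁ + n₂) (m₁ + m₂)
_⊗_ {n₁} {m₁} {n₂} {m₂} A B =
  map (λ r → r ++ replicate n₂ 0) A ++ map (λ r → replicate n₁ 0 ++ r) B

_⊗ᴹ_ : Mor → Mor → Mor
f ⊗ᴹ g = pack (homOf f ⊗ homOf g)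

-- f₁ ⊗ ⋯ ⊗ fₖ of a nonempty vector of morphisms (right-nested; ⊗ is strictly associative)
⨂ : ∀ {k} → Vec Mor (suc k) → Mor
⨂ (f ∷ []) = f
⨂ (f ∷ g ∷ fs) = f ⊗ᴹ ⨂ (g ∷ fs)

Decomposable : Mor → Set
Decomposable f = ∃[ f₁ ] ∃[ f₂ ] (f ≡ f₁ ⊗ᴹ f₂ × f₁ ≢ f × f₂ ≢ f)

FactorsThrough : ∀ {n m} → Hom n m → ℕ → Set
FactorsThrough {n} {m} A k = ∃[ B ] ∃[ C ] (A ≡ _·_ {n} {k} {m} C B)

IsRank : ∀ {n m} → Hom n m → ℕ → Set
IsRank A r = FactorsThrough A r × (∀ k → FactorsThrough A k → r ≤ k)

data Atom : ∀ {n m} → Hom n m → Set where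
  cp₁   : Atom ((1 ∷ []) ∷ (1 ∷ []) ∷ [])
  del₁  : Atom {1} {0} []
  add₁  : Atom ((1 ∷ 1 ∷ []) ∷ [])
  zero₁ : Atom {0} {1} ([] ∷ [])
  σ₁₁   : Atom ((0 ∷ 1 ∷ []) ∷ (1 ∷ 0 ∷ []) ∷ [])
  id₁   : Atom ((1 ∷ []) ∷ [])

data Decomp : ∀ {a b} → Hom a b → Set where
  leaf : ∀ {a b} {f : Hom a b} → Atom f → Decomp f
  tens : ∀ {a₁ b₁ a₂ b₂} {f₁ : Hom a₁ b₁} {f₂ : Hom a₂ b₂} →
         Decomp f₁ → Decomp f₂ → Decomp (f₁ ⊗ f₂)
  seq  : ∀ {a j b} {f₁ : Hom a j} {f₂ : Hom j b} →
         Decomp f₁ → Decomp f₂ → Decomp (f₂ · f₁)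

wd : ∀ {a b} {f : Hom a b} → Decomp f → ℕ
wd (leaf {a} {b} _) = b ⊔ a
wd (tens d₁ d₂) = wd d₁ ⊔ wd d₂
wd (seq {j = j} d₁ d₂) = wd d₁ ⊔ j ⊔ wd d₂

maxᵛ : ∀ {k} → Vec ℕ k → ℕ
maxᵛ = foldr (λ _ → ℕ) _⊔_ 0

{-# OPTIONS --safe #-}
-- Upper bound: if A = C · B factors through r, then B can be built column by column and C row by
-- row from the generators so that every sequential cut carries at most r + 1 wires (r partial
-- sums plus the coordinate being processed), and the middle cut of C · B has r wires. Tensor
-- products do not increase the width, so the factors of f assemble into a decomposition of
-- width at most max rank + 1.
--
-- Lower bound: by induction on a decomposition d of M, every ⊗-indecomposable contiguous
-- submatrix g of M factors through some j ≤ wd d. At a leaf or at a composite through j, g is a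
-- submatrix of a product through j (an atom f : a → b is f · id_a), hence factors through j.
-- At a tensor A ⊗ B, g cannot straddle the two diagonal blocks, for then the zero off-diagonal
-- blocks would split it; so g is a submatrix of A or of B. Each fᵢ is such a submatrix of f.

module Submission where

open import Defs
open import Data.Nat using (ℕ; zero; suc; _+_; _*_; _∸_; _⊔_; _⊓_; _≤_; _<_; z≤n; s≤s; _≡ᵇ_)
open import Data.Nat.Properties
open import Data.Nat.Tactic.RingSolver using (solve-∀)
open import Data.Bool using (if_then_else_)
open import Data.Fin using (Fin; toℕ; fromℕ<) renaming (zero to fzero; suc to fsuc)
open import Data.Fin.Properties using (toℕ-fromℕ<)
open import Data.Vec using (Vec; []; _∷_; map; tabulate; lookup; zipWith; _++_; replicate; head; tail; take; drop)
open import Data.Vec.Properties using (map-cong; map-const; map-∘; map-++; take++drop≡id)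
open import Data.Product using (∃-syntax; _×_; _,_; proj₁; proj₂)
open import Data.Sum using (_⊎_; inj₁; inj₂)
open import Data.Empty using (⊥-elim)
open import Function using (_∘_)
open import Relation.Binary.PropositionalEquality
open import Relation.Nullary using (¬_; yes; no; _×-dec_)
open ≡-Reasoning

-- Entries indexed by ℕ

at : ∀ {A : Set} {n} → A → Vec A n → ℕ → A
at d []       _       = d
at d (x ∷ xs) zero    = x
at d (x ∷ xs) (suc j) = at d xs j

_!_ : ∀ {n} → Vec ℕ n → ℕ → ℕ
xs ! j = at 0 xs j

row : ∀ {n m} → Hom n m → ℕ → Vec ℕ n
row {n} M i = at (replicate n 0) M i

entry : ∀ {n m} → Hom n m → ℕ → ℕ → ℕ
entry M i j = row M i ! j

col : ∀ {n k} → ℕ → Hom n k → Vec ℕ k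
col j B = map (_! j) B

module _ {A : Set} {d : A} where

  at-≥ : ∀ {n} (xs : Vec A n) {j} → n ≤ j → at d xs j ≡ d
  at-≥ []       _         = refl
  at-≥ (x ∷ xs) (s≤s n≤j) = at-≥ xs n≤j

  at-tabulate : ∀ {n} (f : Fin n → A) {j} (j<n : j < n) → at d (tabulate f) j ≡ f (fromℕ< j<n)
  at-tabulate f {zero}  (s≤s _)   = refl
  at-tabulate f {suc j} (s≤s j<n) = at-tabulate (f ∘ fsuc) j<n

  at-lookup : ∀ {n} (xs : Vec A n) (j : Fin n) → at d xs (toℕ j) ≡ lookup xs j
  at-lookup (x ∷ xs) fzero    = refl
  at-lookup (x ∷ xs) (fsuc j) = at-lookup xs j

  at-++ˡ : ∀ {n₁ n₂} (xs : Vec A n₁) (ys : Vec A n₂) {j} → j < n₁ → at d (xs ++ ys) j ≡ at d xs j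
  at-++ˡ (x ∷ xs) ys {zero}  _         = refl
  at-++ˡ (x ∷ xs) ys {suc j} (s≤s j<n) = at-++ˡ xs ys j<n

  at-++ʳ : ∀ {n₁ n₂} (xs : Vec A n₁) (ys : Vec A n₂) j → at d (xs ++ ys) (n₁ + j) ≡ at d ys j
  at-++ʳ []       ys j = refl
  at-++ʳ (x ∷ xs) ys j = at-++ʳ xs ys j

  at-map : ∀ {B : Set} {d′ : B} (f : A → B) → f d ≡ d′ → ∀ {n} (xs : Vec A n) j →
           at d′ (map f xs) j ≡ f (at d xs j)
  at-map f fd≡d′ []       j       = sym fd≡d′
  at-map f fd≡d′ (x ∷ xs) zero    = refl
  at-map f fd≡d′ (x ∷ xs) (suc j) = at-map f fd≡d′ xs j

  at-ext : ∀ {n} (xs ys : Vec A n) → (∀ {j} → j < n → at d xs j ≡ at d ys j) → xs ≡ ys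
  at-ext []       []       _ = refl
  at-ext (x ∷ xs) (y ∷ ys) h = cong₂ _∷_ (h (s≤s z≤n)) (at-ext xs ys (h ∘ s≤s))

replicate-! : ∀ k j → replicate k 0 ! j ≡ 0
replicate-! zero    j       = refl
replicate-! (suc k) zero    = refl
replicate-! (suc k) (suc j) = replicate-! k j

entry-ext : ∀ {n m} (A B : Hom n m) → (∀ {i j} → i < m → j < n → entry A i j ≡ entry B i j) → A ≡ B
entry-ext A B h = at-ext A B λ i<m → at-ext _ _ (h i<m)

entry-≥ : ∀ {n m} (M : Hom n m) i {j} → n ≤ j → entry M i j ≡ 0
entry-≥ M i n≤j = at-≥ (row M i) n≤j

fromEntries : ∀ n m → (ℕ → ℕ → ℕ) → Hom n m
fromEntries n m F = tabulate λ i → tabulate λ j → F (toℕ i) (toℕ j)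

entry-fromEntries : ∀ {n m} F {i j} → i < m → j < n → entry (fromEntries n m F) i j ≡ F i j
entry-fromEntries {n} {m} F {i} {j} i<m j<n = begin
  entry (fromEntries n m F) i j
    ≡⟨ cong (_! j) (at-tabulate _ i<m) ⟩
  tabulate {n = n} (λ j′ → F (toℕ (fromℕ< i<m)) (toℕ j′)) ! j
    ≡⟨ at-tabulate _ j<n ⟩
  F (toℕ (fromℕ< i<m)) (toℕ (fromℕ< j<n))
    ≡⟨ cong₂ F (toℕ-fromℕ< i<m) (toℕ-fromℕ< j<n) ⟩
  F i j ∎

dot-zeroˡ : ∀ {k} (v : Vec ℕ k) → dot (replicate k 0) v ≡ 0
dot-zeroˡ []       = refl
dot-zeroˡ (y ∷ v) = dot-zeroˡ v

dot-zeroʳ : ∀ {k} (u : Vec ℕ k) → dot u (replicate k 0) ≡ 0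
dot-zeroʳ []      = refl
dot-zeroʳ (x ∷ u) = cong₂ _+_ (*-zeroʳ x) (dot-zeroʳ u)

column≡col : ∀ {n k} (B : Hom n k) (j : Fin n) → column j B ≡ col (toℕ j) B
column≡col B j = map-cong (λ r → sym (at-lookup r j)) B

col-≥ : ∀ {n k} (B : Hom n k) {j} → n ≤ j → col j B ≡ replicate k 0
col-≥ B n≤j = trans (map-cong (λ r → at-≥ r n≤j) B) (map-const B 0)

entry-· : ∀ {n k m} (C : Hom k m) (B : Hom n k) i j → entry (C · B) i j ≡ dot (row C i) (col j B)
entry-· {n} []      B i       j = trans (replicate-! n j) (sym (dot-zeroˡ (col j B)))
entry-· (u ∷ C) B (suc i) j = entry-· C B i j
entry-· {n} (u ∷ C) B zero    j with j <? n
... | yes j<n = begin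
  tabulate (λ j′ → dot u (column j′ B)) ! j ≡⟨ at-tabulate _ j<n ⟩
  dot u (column (fromℕ< j<n) B)           ≡⟨ cong (dot u) (column≡col B (fromℕ< j<n)) ⟩
  dot u (col (toℕ (fromℕ< j<n)) B)        ≡⟨ cong (λ j → dot u (col j B)) (toℕ-fromℕ< j<n) ⟩
  dot u (col j B)                         ∎
... | no  j≮n = begin
  tabulate (λ j′ → dot u (column j′ B)) ! j ≡⟨ at-≥ (tabulate λ j′ → dot u (column j′ B)) (≮⇒≥ j≮n) ⟩
  0                                         ≡⟨ dot-zeroʳ u ⟨
  dot u (replicate _ 0)                     ≡⟨ cong (dot u) (col-≥ B (≮⇒≥ j≮n)) ⟨
  dot u (col j B)                           ∎

-- Contiguous submatrices

-- The window may stick out of M: positions outside M read as 0.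
record SubmatrixAt {n m a b} (g : Hom n m) (M : Hom a b) (p q : ℕ) : Set where
  constructor submatrixAt
  field
    entries : ∀ {i j} → i < m → j < n → entry M (p + i) (q + j) ≡ entry g i j

infix 4 _⊑_
_⊑_ : ∀ {n m a b} → Hom n m → Hom a b → Set
g ⊑ M = ∃[ p ] ∃[ q ] SubmatrixAt g M p q

⊑-refl : ∀ {n m} (g : Hom n m) → g ⊑ g
⊑-refl g = 0 , 0 , submatrixAt λ _ _ → refl

⊑-factorsThrough : ∀ {n m a b k} {g : Hom n m} {M : Hom a b} →
  g ⊑ M → FactorsThrough M k → FactorsThrough g k
⊑-factorsThrough {n} {m} {k = k} {g} {M} (p , q , submatrixAt sub) (B , C , M≡CB) =
  B′ , C′ , entry-ext g (C′ · B′) g≗C′B′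
  where
  C′ : Hom k m
  C′ = tabulate λ i → row C (p + toℕ i)
  B′ : Hom n k
  B′ = map (λ r → tabulate λ j → r ! (q + toℕ j)) B
  row-C′ : ∀ {i} → i < m → row C′ i ≡ row C (p + i)
  row-C′ i<m = trans (at-tabulate _ i<m) (cong (λ i → row C (p + i)) (toℕ-fromℕ< i<m))
  col-B′ : ∀ {j} → j < n → col j B′ ≡ col (q + j) B
  col-B′ j<n = trans (sym (map-∘ _ _ B))
    (map-cong (λ r → trans (at-tabulate _ j<n) (cong (λ j → r ! (q + j)) (toℕ-fromℕ< j<n))) B)
  g≗C′B′ : ∀ {i j} → i < m → j < n → entry g i j ≡ entry (C′ · B′) i j
  g≗C′B′ {i} {j} i<m j<n = begin
    entry g i j                         ≡⟨ sub i<m j<n ⟨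
    entry M (p + i) (q + j)             ≡⟨ cong (λ M → entry M (p + i) (q + j)) M≡CB ⟩
    entry (C · B) (p + i) (q + j)       ≡⟨ entry-· C B (p + i) (q + j) ⟩
    dot (row C (p + i)) (col (q + j) B) ≡⟨ cong₂ dot (row-C′ i<m) (col-B′ j<n) ⟨
    dot (row C′ i) (col j B′)           ≡⟨ entry-· C′ B′ i j ⟨
    entry (C′ · B′) i j                 ∎

replicate-++ : ∀ {A : Set} k l (x : A) → replicate k x ++ replicate l x ≡ replicate (k + l) x
replicate-++ zero    l x = refl
replicate-++ (suc k) l x = cong (x ∷_) (replicate-++ k l x)

!-padRight : ∀ {n} (r : Vec ℕ n) k j → (r ++ replicate k 0) ! j ≡ r ! j
!-padRight []      k j       = replicate-! k j
!-padRight (x ∷ r) k zero    = refl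
!-padRight (x ∷ r) k (suc j) = !-padRight r k j

module _ {a₁ b₁ a₂ b₂} (A : Hom a₁ b₁) (B : Hom a₂ b₂) where

  private
    padRight : Vec ℕ a₁ → Vec ℕ (a₁ + a₂)
    padRight r = r ++ replicate a₂ 0
    padLeft : Vec ℕ a₂ → Vec ℕ (a₁ + a₂)
    padLeft r = replicate a₁ 0 ++ r
    row-⊗-top : ∀ {i} → i < b₁ → row (A ⊗ B) i ≡ row A i ++ replicate a₂ 0
    row-⊗-top {i} i<b₁ =
      trans (at-++ˡ (map padRight A) (map padLeft B) i<b₁) (at-map padRight (replicate-++ a₁ a₂ 0) A i)

    row-⊗-bottom : ∀ i → row (A ⊗ B) (b₁ + i) ≡ replicate a₁ 0 ++ row B i
    row-⊗-bottom i =
      trans (at-++ʳ (map padRight A) (map padLeft B) i) (at-map padLeft (replicate-++ a₁ a₂ 0) B i)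

  entry-⊗-top : ∀ {i} j → i < b₁ → entry (A ⊗ B) i j ≡ entry A i j
  entry-⊗-top {i} j i<b₁ = trans (cong (_! j) (row-⊗-top i<b₁)) (!-padRight (row A i) a₂ j)

  entry-⊗-bottomRight : ∀ i j → entry (A ⊗ B) (b₁ + i) (a₁ + j) ≡ entry B i j
  entry-⊗-bottomRight i j = trans (cong (_! (a₁ + j)) (row-⊗-bottom i)) (at-++ʳ (replicate a₁ 0) (row B i) j)

  entry-⊗-bottomLeft : ∀ {i j} → b₁ ≤ i → j < a₁ → entry (A ⊗ B) i j ≡ 0
  entry-⊗-bottomLeft {i} {j} b₁≤i j<a₁ with m≤n⇒∃[o]m+o≡n b₁≤i
  ... | k , refl = trans (cong (_! j) (row-⊗-bottom k))
                         (trans (at-++ˡ (replicate a₁ 0) (row B k) j<a₁) (replicate-! a₁ j))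

  ⊑-⊗ˡ : A ⊑ A ⊗ B
  ⊑-⊗ˡ = 0 , 0 , submatrixAt λ {i} {j} i<b₁ _ → entry-⊗-top j i<b₁

  ⊑-⊗ʳ : ∀ {n m} {g : Hom n m} → g ⊑ B → g ⊑ A ⊗ B
  ⊑-⊗ʳ {g = g} (p , q , submatrixAt sub) = b₁ + p , a₁ + q , submatrixAt λ {i} {j} i<m j<n → begin
    entry (A ⊗ B) (b₁ + p + i) (a₁ + q + j)     ≡⟨ cong₂ (entry (A ⊗ B)) (+-assoc b₁ p i) (+-assoc a₁ q j) ⟩
    entry (A ⊗ B) (b₁ + (p + i)) (a₁ + (q + j)) ≡⟨ entry-⊗-bottomRight (p + i) (q + j) ⟩
    entry B (p + i) (q + j)                     ≡⟨ sub i<m j<n ⟩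
    entry g i j                                 ∎

data Position (k : ℕ) : ℕ → Set where
  before : ∀ {i} → i < k → Position k i
  after  : ∀ i → Position k (k + i)

position : ∀ k i → Position k i
position k i with i <? k
... | yes i<k = before i<k
... | no  i≮k with m≤n⇒∃[o]m+o≡n (≮⇒≥ i≮k)
...   | o , refl = after o

SplitsAt : ∀ {n m} → Hom n m → ℕ → ℕ → Set
SplitsAt {n} {m} g r c =
  (∀ {i j} → i < r → c ≤ j → j < n → entry g i j ≡ 0) ×
  (∀ {i j} → r ≤ i → i < m → j < c → entry g i j ≡ 0)

splitsAt⇒≡⊗ : ∀ {r₁ r₂ c₁ c₂} (g : Hom (c₁ + c₂) (r₁ + r₂)) → SplitsAt g r₁ c₁ →
  g ≡ fromEntries c₁ r₁ (entry g) ⊗ fromEntries c₂ r₂ (λ i j → entry g (r₁ + i) (c₁ + j))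
splitsAt⇒≡⊗ {r₁} {r₂} {c₁} {c₂} g (zero-topRight , zero-bottomLeft) = entry-ext g (G₁ ⊗ G₂) g≗G₁⊗G₂
  where
  G₁ = fromEntries c₁ r₁ (entry g)
  G₂ = fromEntries c₂ r₂ (λ i j → entry g (r₁ + i) (c₁ + j))
  g≗G₁⊗G₂ : ∀ {i j} → i < r₁ + r₂ → j < c₁ + c₂ → entry g i j ≡ entry (G₁ ⊗ G₂) i j
  g≗G₁⊗G₂ {i} {j} i<r j<c with position r₁ i | position c₁ j
  ... | before i<r₁ | before j<c₁ =
    sym (trans (entry-⊗-top G₁ G₂ j i<r₁) (entry-fromEntries (entry g) i<r₁ j<c₁))
  ... | before i<r₁ | after j′ =
    trans (zero-topRight i<r₁ (m≤m+n c₁ j′) j<c)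
          (sym (trans (entry-⊗-top G₁ G₂ (c₁ + j′) i<r₁) (entry-≥ G₁ i (m≤m+n c₁ j′))))
  ... | after i′ | before j<c₁ =
    trans (zero-bottomLeft (m≤m+n r₁ i′) i<r j<c₁) (sym (entry-⊗-bottomLeft G₁ G₂ (m≤m+n r₁ i′) j<c₁))
  ... | after i′ | after j′ =
    sym (trans (entry-⊗-bottomRight G₁ G₂ i′ j′)
               (entry-fromEntries _ (+-cancelˡ-< r₁ i′ r₂ i<r) (+-cancelˡ-< c₁ j′ c₂ j<c)))

m≡m+n⇒n≡0 : ∀ {m n} → m ≡ m + n → n ≡ 0
m≡m+n⇒n≡0 {m} {n} eq = +-cancelˡ-≡ m n 0 (trans (sym eq) (sym (+-identityʳ m)))

⊗-decomposable : ∀ {c₁ r₁ c₂ r₂} (g₁ : Hom c₁ r₁) (g₂ : Hom c₂ r₂) →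
  ¬ (r₁ ≡ 0 × c₁ ≡ 0) → ¬ (r₂ ≡ 0 × c₂ ≡ 0) → Decomposable (pack (g₁ ⊗ g₂))
⊗-decomposable {c₁} {r₁} {c₂} {r₂} g₁ g₂ g₁≢∅ g₂≢∅ = pack g₁ , pack g₂ , refl , g₁≢g , g₂≢g
  where
  g₁≢g : pack g₁ ≢ pack (g₁ ⊗ g₂)
  g₁≢g eq = g₂≢∅ (m≡m+n⇒n≡0 (cong (proj₁ ∘ proj₂) eq) , m≡m+n⇒n≡0 (cong proj₁ eq))
  g₂≢g : pack g₂ ≢ pack (g₁ ⊗ g₂)
  g₂≢g eq = g₁≢∅ (m≡m+n⇒n≡0 (trans (cong (proj₁ ∘ proj₂) eq) (+-comm r₁ r₂)) ,
                  m≡m+n⇒n≡0 (trans (cong proj₁ eq) (+-comm c₁ c₂)))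

splitsAt⇒decomposable : ∀ {n m} (g : Hom n m) {r c} → r ≤ m → c ≤ n → SplitsAt g r c →
  ¬ (r ≡ 0 × c ≡ 0) → ¬ (r ≡ m × c ≡ n) → Decomposable (pack g)
splitsAt⇒decomposable g {r} {c} r≤m c≤n splits nonempty proper
  with m≤n⇒∃[o]m+o≡n r≤m | m≤n⇒∃[o]m+o≡n c≤n
... | r₂ , refl | c₂ , refl =
  subst (Decomposable ∘ pack) (sym (splitsAt⇒≡⊗ g splits))
    (⊗-decomposable G₁ G₂ nonempty λ (r₂≡0 , c₂≡0) → proper (pad r r₂≡0 , pad c c₂≡0))
  where
  G₁ = fromEntries c r (entry g)
  G₂ = fromEntries c₂ r₂ λ i j → entry g (r + i) (c + j)
  pad : ∀ k {l} → l ≡ 0 → k ≡ k + l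
  pad k refl = sym (+-identityʳ k)

<∸⇒+< : ∀ p {i b} → i < b ∸ p → p + i < b
<∸⇒+< zero              i<b   = i<b
<∸⇒+< (suc p) {b = suc b} i<b∸p = s≤s (<∸⇒+< p i<b∸p)

+<⇒<∸ : ∀ p {i b} → p + i < b → i < b ∸ p
+<⇒<∸ zero              p+i<b       = p+i<b
+<⇒<∸ (suc p) {b = suc b} (s≤s p+i<b) = +<⇒<∸ p p+i<b

record Cut (b p m : ℕ) : Set where
  field
    size  : ℕ
    size≤ : size ≤ m
    below : ∀ {i} → i < size → p + i < b
    above : ∀ {i} → size ≤ i → i < m → b ≤ p + i

cut : ∀ b p m → Cut b p m
cut b p m = record
  { size  = (b ∸ p) ⊓ m
  ; size≤ = m⊓n≤n (b ∸ p) m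
  ; below = λ i<size → <∸⇒+< p (m<n⊓o⇒m<n (b ∸ p) m i<size)
  ; above = λ size≤i i<m → ≮⇒≥ λ p+i<b → <⇒≱ (⊓-pres-m< (+<⇒<∸ p p+i<b) i<m) size≤i
  }

open Cut

starts-after : ∀ {b p m} (W : Cut b p (suc m)) → size W ≡ 0 → b ≤ p
starts-after {b} {p} W size≡0 =
  subst (b ≤_) (+-identityʳ p) (above W (subst (_≤ 0) (sym size≡0) z≤n) (s≤s z≤n))

module _ {a₁ b₁ a₂ b₂ n m} {A : Hom a₁ b₁} {B : Hom a₂ b₂} {g : Hom n m} where

  ⊑-⊗-top : ∀ {p q} → (∀ {i} → i < m → p + i < b₁) → SubmatrixAt g (A ⊗ B) p q → g ⊑ A
  ⊑-⊗-top {p} {q} rows-top (submatrixAt sub) = p , q , submatrixAt λ {i} {j} i<m j<n →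
    trans (sym (entry-⊗-top A B (q + j) (rows-top i<m))) (sub i<m j<n)

  ⊑-⊗-bottom : ∀ {p q} → b₁ ≤ p → a₁ ≤ q → SubmatrixAt g (A ⊗ B) p q → g ⊑ B
  ⊑-⊗-bottom b₁≤p a₁≤q (submatrixAt sub) with m≤n⇒∃[o]m+o≡n b₁≤p | m≤n⇒∃[o]m+o≡n a₁≤q
  ... | p , refl | q , refl = p , q , submatrixAt λ {i} {j} i<m j<n → begin
    entry B (p + i) (q + j)                     ≡⟨ entry-⊗-bottomRight A B (p + i) (q + j) ⟨
    entry (A ⊗ B) (b₁ + (p + i)) (a₁ + (q + j)) ≡⟨ cong₂ (entry (A ⊗ B)) (+-assoc b₁ p i) (+-assoc a₁ q j) ⟨
    entry (A ⊗ B) (b₁ + p + i) (a₁ + q + j)     ≡⟨ sub i<m j<n ⟩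
    entry g i j                                 ∎

  submatrixAt-⊗-splitsAt : ∀ {p q} → SubmatrixAt g (A ⊗ B) p q →
    (R : Cut b₁ p m) (C : Cut a₁ q n) → SplitsAt g (size R) (size C)
  submatrixAt-⊗-splitsAt {p} {q} (submatrixAt sub) R C = zero-topRight , zero-bottomLeft
    where
    zero-topRight : ∀ {i j} → i < size R → size C ≤ j → j < n → entry g i j ≡ 0
    zero-topRight {i} {j} i<r c≤j j<n = begin
      entry g i j                   ≡⟨ sub (<-≤-trans i<r (size≤ R)) j<n ⟨
      entry (A ⊗ B) (p + i) (q + j) ≡⟨ entry-⊗-top A B (q + j) (below R i<r) ⟩
      entry A (p + i) (q + j)       ≡⟨ entry-≥ A (p + i) (above C c≤j j<n) ⟩
      0                             ∎
    zero-bottomLeft : ∀ {i j} → size R ≤ i → i < m → j < size C → entry g i j ≡ 0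
    zero-bottomLeft {i} {j} r≤i i<m j<c = begin
      entry g i j                   ≡⟨ sub i<m (<-≤-trans j<c (size≤ C)) ⟨
      entry (A ⊗ B) (p + i) (q + j) ≡⟨ entry-⊗-bottomLeft A B (above R r≤i i<m) (below C j<c) ⟩
      0                             ∎

⊑-⊗ : ∀ {a₁ b₁ a₂ b₂ n m} {A : Hom a₁ b₁} {B : Hom a₂ b₂} {g : Hom (suc n) (suc m)} →
  g ⊑ A ⊗ B → g ⊑ A ⊎ g ⊑ B ⊎ Decomposable (pack g)
⊑-⊗ {a₁} {b₁} {n = n} {m} {A} {B} {g} (p , q , sub) = by-cuts (cut b₁ p (suc m)) (cut a₁ q (suc n))
  where
  by-cuts : Cut b₁ p (suc m) → Cut a₁ q (suc n) → g ⊑ A ⊎ g ⊑ B ⊎ Decomposable (pack g)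
  by-cuts R C with size R ≟ suc m
  ... | yes all-rows-top =
          -- columns of g lying right of A are zero in A ⊗ B and read as 0 in A
          inj₁ (⊑-⊗-top {A = A} {B} (λ {i} i<m → below R (subst (i <_) (sym all-rows-top) i<m)) sub)
  ... | no rows-straddle with size R ≟ 0 ×-dec size C ≟ 0
  ...   | yes (R≡0 , C≡0) = inj₂ (inj₁ (⊑-⊗-bottom {A = A} {B} (starts-after R R≡0) (starts-after C C≡0) sub))
  ...   | no nonempty     = inj₂ (inj₂ (splitsAt⇒decomposable g (size≤ R) (size≤ C)
                                (submatrixAt-⊗-splitsAt {A = A} {B} sub R C) nonempty (rows-straddle ∘ proj₁)))

identity : ∀ n → Hom n n
identity n = fromEntries n n λ i j → if i ≡ᵇ j then 1 else 0

atom-factorsThroughSource : ∀ {a b} {f : Hom a b} → Atom f → FactorsThrough f a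
atom-factorsThroughSource {f = f} cp₁   = identity 1 , f , refl
atom-factorsThroughSource {f = f} del₁  = identity 1 , f , refl
atom-factorsThroughSource {f = f} add₁  = identity 2 , f , refl
atom-factorsThroughSource {f = f} zero₁ = identity 0 , f , refl
atom-factorsThroughSource {f = f} σ₁₁   = identity 2 , f , refl
atom-factorsThroughSource {f = f} id₁   = identity 1 , f , refl

factorsThrough-zeroSource : ∀ {m} (g : Hom 0 m) → FactorsThrough g 0
factorsThrough-zeroSource []       = [] , [] , refl
factorsThrough-zeroSource ([] ∷ g) with factorsThrough-zeroSource g
... | B , C , g≡CB = B , [] ∷ C , cong ([] ∷_) g≡CB

factorsThrough-zeroTarget : ∀ {n} (g : Hom n 0) → FactorsThrough g 0
factorsThrough-zeroTarget [] = [] , [] , refl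

indecomposable-⊑-factorsThrough-≤wd : ∀ {a b} {M : Hom a b} (d : Decomp M) {n m} {g : Hom n m} →
  g ⊑ M → ¬ Decomposable (pack g) → ∃[ j ] j ≤ wd d × FactorsThrough g j
indecomposable-⊑-factorsThrough-≤wd d {zero} {g = g} _ _ = 0 , z≤n , factorsThrough-zeroSource g
indecomposable-⊑-factorsThrough-≤wd d {suc n} {zero} {g} _ _ = 0 , z≤n , factorsThrough-zeroTarget g
indecomposable-⊑-factorsThrough-≤wd (leaf {a} {b} atom) {suc n} {suc m} g⊑M _ =
  a , m≤n⊔m b a , ⊑-factorsThrough g⊑M (atom-factorsThroughSource atom)
indecomposable-⊑-factorsThrough-≤wd (seq {j = j} {f₁ = f₁} {f₂ = f₂} d₁ d₂) {suc n} {suc m} g⊑M _ =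
  j , ≤-trans (m≤n⊔m (wd d₁) j) (m≤m⊔n _ (wd d₂)) , ⊑-factorsThrough g⊑M (f₁ , f₂ , refl)
indecomposable-⊑-factorsThrough-≤wd (tens d₁ d₂) {suc n} {suc m} g⊑M g-indec with ⊑-⊗ g⊑M
... | inj₁ g⊑A =
  let j , j≤wd , fac = indecomposable-⊑-factorsThrough-≤wd d₁ g⊑A g-indec
  in j , ≤-trans j≤wd (m≤m⊔n (wd d₁) (wd d₂)) , fac
... | inj₂ (inj₁ g⊑B) =
  let j , j≤wd , fac = indecomposable-⊑-factorsThrough-≤wd d₂ g⊑B g-indec
  in j , ≤-trans j≤wd (m≤n⊔m (wd d₁) (wd d₂)) , fac
... | inj₂ (inj₂ g-dec) = ⊥-elim (g-indec g-dec)

⊑-⨂ : ∀ {k} (fs : Vec Mor (suc k)) i → homOf (lookup fs i) ⊑ homOf (⨂ fs)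
⊑-⨂ (f ∷ [])     fzero    = ⊑-refl (homOf f)
⊑-⨂ (f ∷ g ∷ fs) fzero    = ⊑-⊗ˡ (homOf f) (homOf (⨂ (g ∷ fs)))
⊑-⨂ (f ∷ g ∷ fs) (fsuc i) = ⊑-⊗ʳ (homOf f) (homOf (⨂ (g ∷ fs))) (⊑-⨂ (g ∷ fs) i)

maxᵛ-lub : ∀ {k} (rs : Vec ℕ k) {w} → (∀ i → lookup rs i ≤ w) → maxᵛ rs ≤ w
maxᵛ-lub []       _     = z≤n
maxᵛ-lub (r ∷ rs) rs≤w = ⊔-lub (rs≤w fzero) (maxᵛ-lub rs (rs≤w ∘ fsuc))

-- Matrices as linear maps

act : ∀ {n m} → Hom n m → Vec ℕ n → Vec ℕ m
act A x = map (λ r → dot r x) A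

dot-ext : ∀ {n} (r s : Vec ℕ n) → (∀ x → dot r x ≡ dot s x) → r ≡ s
dot-ext []      []      _ = refl
dot-ext {suc n} (a ∷ r) (b ∷ s) r≗s = cong₂ _∷_ heads (dot-ext r s tails)
  where
  heads : a ≡ b
  heads = begin
    a                             ≡⟨ sym (trans (cong₂ _+_ (*-identityʳ a) (dot-zeroʳ r)) (+-identityʳ a)) ⟩
    a * 1 + dot r (replicate n 0) ≡⟨ r≗s (1 ∷ replicate n 0) ⟩
    b * 1 + dot s (replicate n 0) ≡⟨ trans (cong₂ _+_ (*-identityʳ b) (dot-zeroʳ s)) (+-identityʳ b) ⟩
    b                             ∎
  tails : ∀ x → dot r x ≡ dot s x
  tails x = begin
    dot r x         ≡⟨ cong (_+ dot r x) (sym (*-zeroʳ a)) ⟩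
    a * 0 + dot r x ≡⟨ r≗s (0 ∷ x) ⟩
    b * 0 + dot s x ≡⟨ cong (_+ dot s x) (*-zeroʳ b) ⟩
    dot s x         ∎

act-ext : ∀ {n m} (A B : Hom n m) → (∀ x → act A x ≡ act B x) → A ≡ B
act-ext []      []      _ = refl
act-ext (r ∷ A) (s ∷ B) A≗B = cong₂ _∷_ (dot-ext r s (cong head ∘ A≗B)) (act-ext A B (cong tail ∘ A≗B))

dot-tabulate-zero : ∀ {n} (x : Vec ℕ n) → dot (tabulate {n = n} λ _ → 0) x ≡ 0
dot-tabulate-zero []      = refl
dot-tabulate-zero (y ∷ x) = dot-tabulate-zero x

dot-tabulate-+ : ∀ {n} (f g : Fin n → ℕ) x → dot (tabulate λ j → f j + g j) x ≡ dot (tabulate f) x + dot (tabulate g) x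
dot-tabulate-+ f g []      = refl
dot-tabulate-+ f g (y ∷ x) rewrite dot-tabulate-+ (f ∘ fsuc) (g ∘ fsuc) x =
  regroup (f fzero) (g fzero) y (dot (tabulate (f ∘ fsuc)) x) (dot (tabulate (g ∘ fsuc)) x)
  where
  regroup : ∀ a b y F G → (a + b) * y + (F + G) ≡ a * y + F + (b * y + G)
  regroup = solve-∀

dot-tabulate-* : ∀ {n} c (r x : Vec ℕ n) → dot (tabulate λ j → c * lookup r j) x ≡ c * dot r x
dot-tabulate-* c []      []      = sym (*-zeroʳ c)
dot-tabulate-* c (a ∷ r) (y ∷ x) rewrite dot-tabulate-* c r x = regroup c a y (dot r x)
  where
  regroup : ∀ c a y D → c * a * y + c * D ≡ c * (a * y + D)
  regroup = solve-∀

dot-act : ∀ {n k} (u : Vec ℕ k) (B : Hom n k) x → dot (tabulate λ j → dot u (column j B)) x ≡ dot u (act B x)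
dot-act []      []      x = dot-tabulate-zero x
dot-act (c ∷ u) (r ∷ B) x = begin
  dot (tabulate λ j → c * lookup r j + dot u (column j B)) x
    ≡⟨ dot-tabulate-+ (λ j → c * lookup r j) (λ j → dot u (column j B)) x ⟩
  dot (tabulate λ j → c * lookup r j) x + dot (tabulate λ j → dot u (column j B)) x
    ≡⟨ cong₂ _+_ (dot-tabulate-* c r x) (dot-act u B x) ⟩
  c * dot r x + dot u (act B x) ∎

act-· : ∀ {n k m} (C : Hom k m) (B : Hom n k) x → act (C · B) x ≡ act C (act B x)
act-· []      B x = refl
act-· (u ∷ C) B x = cong₂ _∷_ (dot-act u B x) (act-· C B x)

dot-++ : ∀ {n₁ n₂} (r : Vec ℕ n₁) (s : Vec ℕ n₂) u v → dot (r ++ s) (u ++ v) ≡ dot r u + dot s v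
dot-++ []      s []      v = refl
dot-++ (a ∷ r) s (y ∷ u) v = trans (cong (a * y +_) (dot-++ r s u v)) (sym (+-assoc (a * y) (dot r u) (dot s v)))

act-⊗ : ∀ {a₁ b₁ a₂ b₂} (A : Hom a₁ b₁) (B : Hom a₂ b₂) u v → act (A ⊗ B) (u ++ v) ≡ act A u ++ act B v
act-⊗ {a₁} {a₂ = a₂} A B u v = begin
  act (A ⊗ B) (u ++ v)
    ≡⟨ map-++ (λ r → dot r (u ++ v)) (map padRight A) (map padLeft B) ⟩
  map (λ r → dot r (u ++ v)) (map padRight A) ++ map (λ r → dot r (u ++ v)) (map padLeft B)
    ≡⟨ cong₂ _++_ (trans (sym (map-∘ _ padRight A)) (map-cong dot-padRight A))
                  (trans (sym (map-∘ _ padLeft B)) (map-cong dot-padLeft B)) ⟩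
  act A u ++ act B v ∎
  where
  padRight : Vec ℕ a₁ → Vec ℕ (a₁ + a₂)
  padRight r = r ++ replicate a₂ 0
  padLeft : Vec ℕ a₂ → Vec ℕ (a₁ + a₂)
  padLeft r = replicate a₁ 0 ++ r
  dot-padRight : ∀ r → dot (padRight r) (u ++ v) ≡ dot r u
  dot-padRight r = trans (dot-++ r _ u v) (trans (cong (dot r u +_) (dot-zeroˡ v)) (+-identityʳ _))
  dot-padLeft : ∀ r → dot (padLeft r) (u ++ v) ≡ dot r v
  dot-padLeft r = trans (dot-++ (replicate a₁ 0) r u v) (cong (_+ dot r v) (dot-zeroˡ u))

-- Decompositions of width rank + 1

record Circuit {n m} (w : ℕ) (h : Vec ℕ n → Vec ℕ m) : Set where
  constructor circuit
  field
    matrix  : Hom n m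
    decomp  : Decomp matrix
    width≤  : wd decomp ≤ w
    acts    : ∀ x → act matrix x ≡ h x

infixr 5 _⨾⟨_⟩_
infixr 6 _⊗ᶜ_

_⨾⟨_⟩_ : ∀ {a j b w} {h₁ : Vec ℕ a → Vec ℕ j} {h₂ : Vec ℕ j → Vec ℕ b} →
         Circuit w h₁ → j ≤ w → Circuit w h₂ → Circuit w (h₂ ∘ h₁)
_⨾⟨_⟩_ {h₁ = h₁} (circuit X₁ d₁ d₁≤w X₁≗h₁) j≤w (circuit X₂ d₂ d₂≤w X₂≗h₂) =
  circuit (X₂ · X₁) (seq d₁ d₂) (⊔-lub (⊔-lub d₁≤w j≤w) d₂≤w)
    λ x → trans (act-· X₂ X₁ x) (trans (cong (act X₂) (X₁≗h₁ x)) (X₂≗h₂ (h₁ x)))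

_⊗ᶠ_ : ∀ {a₁ b₁ a₂ b₂} → (Vec ℕ a₁ → Vec ℕ b₁) → (Vec ℕ a₂ → Vec ℕ b₂) → Vec ℕ (a₁ + a₂) → Vec ℕ (b₁ + b₂)
_⊗ᶠ_ {a₁} h₁ h₂ x = h₁ (take a₁ x) ++ h₂ (drop a₁ x)

_⊗ᶜ_ : ∀ {a₁ b₁ a₂ b₂ w} {h₁ : Vec ℕ a₁ → Vec ℕ b₁} {h₂ : Vec ℕ a₂ → Vec ℕ b₂} →
       Circuit w h₁ → Circuit w h₂ → Circuit w (h₁ ⊗ᶠ h₂)
_⊗ᶜ_ {a₁} (circuit X₁ d₁ d₁≤w X₁≗h₁) (circuit X₂ d₂ d₂≤w X₂≗h₂) =
  circuit (X₁ ⊗ X₂) (tens d₁ d₂) (⊔-lub d₁≤w d₂≤w) λ x → begin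
    act (X₁ ⊗ X₂) x                                  ≡⟨ cong (act (X₁ ⊗ X₂)) (sym (take++drop≡id a₁ x)) ⟩
    act (X₁ ⊗ X₂) (take a₁ x ++ drop a₁ x)           ≡⟨ act-⊗ X₁ X₂ (take a₁ x) (drop a₁ x) ⟩
    act X₁ (take a₁ x) ++ act X₂ (drop a₁ x)         ≡⟨ cong₂ _++_ (X₁≗h₁ (take a₁ x)) (X₂≗h₂ (drop a₁ x)) ⟩
    _ ∎

≗-circuit : ∀ {n m w} {h h′ : Vec ℕ n → Vec ℕ m} → (∀ x → h x ≡ h′ x) → Circuit w h → Circuit w h′
≗-circuit h≗h′ (circuit X d d≤w X≗h) = circuit X d d≤w λ x → trans (X≗h x) (h≗h′ x)

widen : ∀ {n m w w′} {h : Vec ℕ n → Vec ℕ m} → w ≤ w′ → Circuit w h → Circuit w′ h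
widen w≤w′ (circuit X d d≤w X≗h) = circuit X d (≤-trans d≤w w≤w′) X≗h

atomᶜ : ∀ {a b} {f : Hom a b} → Atom f → Circuit (b ⊔ a) (act f)
atomᶜ atom = circuit _ (leaf atom) ≤-refl λ _ → refl

1*y+0≡y : ∀ y → 1 * y + 0 ≡ y
1*y+0≡y y = trans (+-identityʳ (1 * y)) (*-identityˡ y)

copyᶜ : Circuit {1} {2} 2 λ { (y ∷ []) → y ∷ y ∷ [] }
copyᶜ = ≗-circuit (λ { (y ∷ []) → cong₂ (λ a b → a ∷ b ∷ []) (1*y+0≡y y) (1*y+0≡y y) }) (atomᶜ cp₁)

discardᶜ : Circuit 1 λ (_ : Vec ℕ 1) → []
discardᶜ = atomᶜ del₁

addᶜ : Circuit {2} {1} 2 λ { (y ∷ z ∷ []) → y + z ∷ [] }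
addᶜ = ≗-circuit (λ { (y ∷ z ∷ []) → cong (_∷ []) (cong₂ _+_ (*-identityˡ y) (1*y+0≡y z)) }) (atomᶜ add₁)

zeroᶜ : Circuit 1 λ (_ : Vec ℕ 0) → 0 ∷ []
zeroᶜ = ≗-circuit (λ { [] → refl }) (atomᶜ zero₁)

swapᶜ : Circuit {2} {2} 2 λ { (y ∷ z ∷ []) → z ∷ y ∷ [] }
swapᶜ = ≗-circuit (λ { (y ∷ z ∷ []) → cong₂ (λ a b → a ∷ b ∷ []) (1*y+0≡y z) (1*y+0≡y y) }) (atomᶜ σ₁₁)

idᶜ : Circuit 1 λ (x : Vec ℕ 1) → x
idᶜ = ≗-circuit (λ { (y ∷ []) → cong (_∷ []) (1*y+0≡y y) }) (atomᶜ id₁)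

emptyᶜ : Circuit 1 λ (_ : Vec ℕ 0) → []
emptyᶜ = zeroᶜ ⨾⟨ ≤-refl ⟩ discardᶜ

zerosᶜ : ∀ r → Circuit 1 λ (_ : Vec ℕ 0) → replicate r 0
zerosᶜ zero    = emptyᶜ
zerosᶜ (suc r) = ≗-circuit (λ { [] → refl }) (zeroᶜ ⊗ᶜ zerosᶜ r)

discardsᶜ : ∀ r → Circuit 1 λ (_ : Vec ℕ r) → []
discardsᶜ zero    = ≗-circuit (λ { [] → refl }) emptyᶜ
discardsᶜ (suc r) = discardᶜ ⊗ᶜ discardsᶜ r

idsᶜ : ∀ k → Circuit 1 λ (x : Vec ℕ k) → x
idsᶜ zero    = ≗-circuit (λ { [] → refl }) emptyᶜ
idsᶜ (suc k) = ≗-circuit (λ { (y ∷ x) → refl }) (idᶜ ⊗ᶜ idsᶜ k)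

scaleᶜ : ∀ c → Circuit {1} {1} 2 λ { (y ∷ []) → c * y ∷ [] }
scaleᶜ zero    = ≗-circuit (λ { (y ∷ []) → refl }) (widen (s≤s z≤n) discardᶜ ⨾⟨ z≤n ⟩ widen (s≤s z≤n) zeroᶜ)
scaleᶜ (suc c) = ≗-circuit (λ { (y ∷ []) → refl })
  (copyᶜ ⨾⟨ ≤-refl ⟩ (widen (s≤s z≤n) idᶜ ⊗ᶜ scaleᶜ c) ⨾⟨ ≤-refl ⟩ addᶜ)

axpyᶜ : ∀ c → Circuit {2} {1} 2 λ { (y ∷ z ∷ []) → c * y + z ∷ [] }
axpyᶜ c = ≗-circuit (λ { (y ∷ z ∷ []) → refl }) ((scaleᶜ c ⊗ᶜ widen (s≤s z≤n) idᶜ) ⨾⟨ ≤-refl ⟩ addᶜ)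

axpyKeepᶜ : ∀ c → Circuit {2} {2} 3 λ { (y ∷ z ∷ []) → c * y + z ∷ y ∷ [] }
axpyKeepᶜ c = ≗-circuit (λ { (y ∷ z ∷ []) → refl })
  (   (widen (s≤s (s≤s z≤n)) copyᶜ ⊗ᶜ widen (s≤s z≤n) idᶜ)
  ⨾⟨ ≤-refl ⟩ (widen (s≤s z≤n) idᶜ ⊗ᶜ widen (s≤s (s≤s z≤n)) swapᶜ)
  ⨾⟨ ≤-refl ⟩ (widen (s≤s (s≤s z≤n)) (axpyᶜ c) ⊗ᶜ widen (s≤s z≤n) idᶜ))

addScaled : ∀ {r} → Vec ℕ r → Vec ℕ (suc r) → Vec ℕ r
addScaled b (y ∷ z) = zipWith (λ bᵢ zᵢ → bᵢ * y + zᵢ) b z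

addScaledᶜ : ∀ {r} (b : Vec ℕ r) → Circuit (suc r) (addScaled b)
addScaledᶜ []                = ≗-circuit (λ { (y ∷ []) → refl }) discardᶜ
addScaledᶜ (b₁ ∷ [])         = ≗-circuit (λ { (y ∷ z₁ ∷ []) → refl }) (axpyᶜ b₁)
addScaledᶜ (b₁ ∷ b₂ ∷ b) = ≗-circuit (λ { (y ∷ z₁ ∷ z) → refl })
  (   (widen (s≤s (s≤s (s≤s z≤n))) (axpyKeepᶜ b₁) ⊗ᶜ widen (s≤s z≤n) (idsᶜ _))
  ⨾⟨ ≤-refl ⟩ (widen (s≤s z≤n) idᶜ ⊗ᶜ widen (n≤1+n _) (addScaledᶜ (b₂ ∷ b))))

prependDotᶜ : ∀ {r} (c : Vec ℕ r) → Circuit (suc r) λ z → dot c z ∷ z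
prependDotᶜ []            = ≗-circuit (λ { [] → refl }) zeroᶜ
prependDotᶜ (c₁ ∷ [])     = ≗-circuit (λ { (z₁ ∷ []) → cong (_∷ z₁ ∷ []) (sym (+-identityʳ (c₁ * z₁))) })
  (copyᶜ ⨾⟨ ≤-refl ⟩ (scaleᶜ c₁ ⊗ᶜ widen (s≤s z≤n) idᶜ))
prependDotᶜ (c₁ ∷ c₂ ∷ c) = ≗-circuit (λ { (z₁ ∷ z) → refl })
  (   (widen (s≤s z≤n) idᶜ ⊗ᶜ widen (n≤1+n _) (prependDotᶜ (c₂ ∷ c)))
  ⨾⟨ ≤-refl ⟩ (widen (s≤s (s≤s (s≤s z≤n))) (axpyKeepᶜ c₁) ⊗ᶜ widen (s≤s z≤n) (idsᶜ _)))

act-zeroSource : ∀ {r} (B : Hom 0 r) → act B [] ≡ replicate r 0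
act-zeroSource []       = refl
act-zeroSource ([] ∷ B) = cong (0 ∷_) (act-zeroSource B)

act-∷ : ∀ {n r} (B : Hom (suc n) r) y x → addScaled (map head B) (y ∷ act (map tail B) x) ≡ act B (y ∷ x)
act-∷ []            y x = refl
act-∷ ((a ∷ u) ∷ B) y x = cong (a * y + dot u x ∷_) (act-∷ B y x)

columnsᶜ : ∀ {n r} (B : Hom n r) → Circuit (suc r) (act B)
columnsᶜ {zero}  {r} B = ≗-circuit (λ { [] → sym (act-zeroSource B) }) (widen (s≤s z≤n) (zerosᶜ r))
columnsᶜ {suc n}     B = ≗-circuit (λ { (y ∷ x) → act-∷ B y x })
  ((widen (s≤s z≤n) idᶜ ⊗ᶜ columnsᶜ (map tail B)) ⨾⟨ ≤-refl ⟩ addScaledᶜ (map head B))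

rowsᶜ : ∀ {r m} (C : Hom r m) → Circuit (suc r) (act C)
rowsᶜ {r} []      = widen (s≤s z≤n) (discardsᶜ r)
rowsᶜ     (c ∷ C) = prependDotᶜ c ⨾⟨ ≤-refl ⟩ (widen (s≤s z≤n) idᶜ ⊗ᶜ rowsᶜ C)

factorsThrough⇒width≤suc : ∀ {n m} {A : Hom n m} {r} → FactorsThrough A r → ∃[ d ] wd {f = A} d ≤ suc r
factorsThrough⇒width≤suc {A = A} {r} (B , C , A≡CB) with columnsᶜ B ⨾⟨ n≤1+n r ⟩ rowsᶜ C
... | circuit X d d≤1+r X≗CB = subst (λ M → ∃[ d ] wd {f = M} d ≤ suc r) X≡A (d , d≤1+r)
  where
  X≡A : X ≡ A
  X≡A = act-ext X A λ x → trans (X≗CB x) (trans (sym (act-· C B x)) (cong (λ M → act M x) (sym A≡CB)))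

⨂-decomposition : ∀ {k} (fs : Vec Mor (suc k)) {w} →
  (∀ i → ∃[ d ] wd {f = homOf (lookup fs i)} d ≤ w) → ∃[ d ] wd {f = homOf (⨂ fs)} d ≤ w
⨂-decomposition (f ∷ [])     ds = ds fzero
⨂-decomposition (f ∷ g ∷ fs) ds =
  let d₁ , d₁≤w = ds fzero
      d₂ , d₂≤w = ⨂-decomposition (g ∷ fs) (ds ∘ fsuc)
  in tens d₁ d₂ , ⊔-lub d₁≤w d₂≤w

lookup≤maxᵛ : ∀ {k} (rs : Vec ℕ k) i → lookup rs i ≤ maxᵛ rs
lookup≤maxᵛ (r ∷ rs) fzero    = m≤m⊔n r (maxᵛ rs)
lookup≤maxᵛ (r ∷ rs) (fsuc i) = ≤-trans (lookup≤maxᵛ rs i) (m≤n⊔m r (maxᵛ rs))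

corollary4p11 : ∀ {k} (fs : Vec Mor (suc k)) (rs : Vec ℕ (suc k)) →
    (∀ i → IsRank (homOf (lookup fs i)) (lookup rs i)) →
    (∃[ d ] (wd {f = homOf (⨂ fs)} d ≤ maxᵛ rs + 1))
    × ((∀ i → ¬ Decomposable (lookup fs i)) →
       ∀ (d : Decomp (homOf (⨂ fs))) → maxᵛ rs ≤ wd d)
corollary4p11 fs rs ranks = upper , lower
  where
  upper : ∃[ d ] wd {f = homOf (⨂ fs)} d ≤ maxᵛ rs + 1
  upper = ⨂-decomposition fs λ i →
    let d , d≤1+r = factorsThrough⇒width≤suc (proj₁ (ranks i))
    in d , ≤-trans d≤1+r (subst (suc (lookup rs i) ≤_) (+-comm 1 (maxᵛ rs)) (s≤s (lookup≤maxᵛ rs i)))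
  lower : (∀ i → ¬ Decomposable (lookup fs i)) → ∀ d → maxᵛ rs ≤ wd d
  lower indecomposable d = maxᵛ-lub rs λ i →
    let j , j≤wd , factors = indecomposable-⊑-factorsThrough-≤wd d (⊑-⨂ fs i) (indecomposable i)
    in ≤-trans (proj₂ (ranks i) j factors) j≤wd
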